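{- Let $G$ be a finite group and let $x\in G$ be a vertex of $D(G)$, and write $\circ(x)$ for the order of $x$. (1) If $\circ(x)=p^\alpha$ for some prime $p$, then there exist a prime $q\neq p$ and $y\in G$ with $\circ(y)=q^\beta$ (for some $\beta$) such that $x\sim y$ in $D(G)$. (2) If $\circ(x)$ is not a prime power, then there exist a prime $p$ and $y\in G$ with $\circ(y)=p^\alpha$ (for some $\alpha$) such that $x\sim y$ in $D(G)$.
   Context: For a group $G$, the power graph $\mathsf{Pow}(G)$ has vertex set $G$, with distinct $a,b$ adjacent iff $a\in\langle b\rangle$ or $b\in\langle a\rangle$. The enhanced power graph $\mathsf{EPow}(G)$ has vertex set $G$, with distinct $a,b$ adjacent iff $\langle a,b\rangle$ is cyclic. The difference graph $D(G)$ is the graph $\mathsf{EPow}(G)-\mathsf{Pow}(G)$ with all isolated vertices removed; thus $x\sim y$ in $D(G)$ iff $\langle x,y\rangle$ is cyclic, $x\notin\langle y\rangle$ and $y\notin\langle x\rangle$. -}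

module Defs where

open import Level using (_⊔_)
open import Algebra.Bundles using (Group)
open import Data.Nat using (ℕ; zero; suc; _<_; _^_)
open import Data.Integer using (ℤ; +_; -[1+_])
open import Data.Fin using (Fin)
open import Data.Product using (Σ; ∃; _×_)
open import Data.Nat.Primality using (Prime)
open import Relation.Binary.PropositionalEquality using (_≡_)
open import Relation.Nullary using (¬_)

IsFinite : ∀ {c ℓ} → Group c ℓ → Set (c ⊔ ℓ)
IsFinite G = Σ ℕ λ n → Σ (Fin n → Carrier) λ f →
    (∀ x → ∃ λ i → f i ≈ x) × (∀ i j → f i ≈ f j → i ≡ j)
  where open Group G

IsPrimePower : ℕ → Set
IsPrimePower n = Σ ℕ λ p → Σ ℕ λ α → Prime p × n ≡ p ^ α

module _ {c ℓ} (G : Group c ℓ) where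
  open Group G

  powℕ : Carrier → ℕ → Carrier
  powℕ x zero    = ε
  powℕ x (suc k) = x ∙ powℕ x k

  powℤ : Carrier → ℤ → Carrier
  powℤ x (+ k)      = powℕ x k
  powℤ x -[1+ k ]   = powℕ (x ⁻¹) (suc k)

  InCyc : Carrier → Carrier → Set ℓ
  InCyc a b = ∃ λ (k : ℤ) → a ≈ powℤ b k

  IsOrder : Carrier → ℕ → Set ℓ
  IsOrder x n = 0 < n × powℕ x n ≈ ε × (∀ j → 0 < j → j < n → ¬ (powℕ x j ≈ ε))

  data Gen2 (x y : Carrier) : Carrier → Set (c ⊔ ℓ) where
    gen-x : Gen2 x y x
    gen-y : Gen2 x y y
    gen-ε : Gen2 x y ε
    gen-∙ : ∀ {a b} → Gen2 x y a → Gen2 x y b → Gen2 x y (a ∙ b)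
    gen-⁻¹ : ∀ {a} → Gen2 x y a → Gen2 x y (a ⁻¹)
    gen-≈ : ∀ {a b} → a ≈ b → Gen2 x y a → Gen2 x y b

  -- ⟨x , y⟩ is cyclic: it equals ⟨g⟩ for some g
  -- (g ∈ ⟨x,y⟩ and x, y ∈ ⟨g⟩, so ⟨g⟩ = ⟨x,y⟩)
  CyclicPair : Carrier → Carrier → Set (c ⊔ ℓ)
  CyclicPair x y = ∃ λ g → Gen2 x y g × InCyc x g × InCyc y g

  DAdj : Carrier → Carrier → Set (c ⊔ ℓ)
  DAdj x y = CyclicPair x y × ¬ InCyc x y × ¬ InCyc y x

  -- x is a vertex of D(G) (not isolated)
  IsVertexD : Carrier → Set (c ⊔ ℓ)
  IsVertexD x = ∃ λ y → DAdj x y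

-- The vertex x and a D-neighbour y both lie in a cyclic group ⟨g⟩ of order m, where an element
-- u lies in ⟨v⟩ exactly when ∘(u) divides ∘(v), so adjacency to x inside ⟨g⟩ is decided by orders
-- alone.  The candidates are the generators g ^ (m / q ^ e) of the Sylow q-subgroups of ⟨g⟩
-- (q ^ e the exact power of q dividing m); such an element is adjacent to x as soon as neither
-- of q ^ e and ∘(x) divides the other.  If ∘(x) = p ^ α, a prime q ≠ p dividing m exists, since
-- otherwise the orders of x and y would be comparable p-powers.  If ∘(x) is not a prime power,
-- ∘(x) is a proper divisor of m (otherwise y ∈ ⟨x⟩), and any prime q dividing m / ∘(x) works.
module Submission where

open import Defs
open import Algebra.Bundles using (Group)
open import Data.Nat using (ℕ; zero; suc; z<s; _+_; _*_; _∸_; _^_; _≤_; _<_; z≤n; s≤s; NonZero;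
  >-nonZero; >-nonZero⁻¹; ≢-nonZero⁻¹; nonTrivial⇒n>1)
open import Data.Nat.Properties
open import Data.Nat.Divisibility
open import Data.Nat.DivMod using (_%_; _/_; m≡m%n+[m/n]*n; m%n<n)
open import Data.Nat.GCD using (gcd; gcd[m,n]∣m; gcd[m,n]∣n; gcd-GCD; module Bézout)
open import Data.Nat.Coprimality using (Coprime; coprime-Bézout)
open import Data.Nat.Primality
  using (Prime; ¬prime[1]; prime⇒irreducible; prime⇒nonZero; prime⇒nonTrivial; euclidsLemma)
open import Data.Nat.Primality.Factorisation using (factorise)
open import Data.Nat.ListAction using (product)
open import Data.Nat.Induction using (<-wellFounded)
open import Algebra.Properties.CommutativeSemigroup *-commutativeSemigroup using (x∙yz≈y∙xz)
open import Data.Integer using (+_; -[1+_])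
open import Data.Fin using (toℕ)
import Data.Fin.Properties as Fin
open import Data.List using ([]; _∷_)
open import Data.List.Relation.Unary.All using (_∷_)
open import Data.Product using (Σ; ∃; ∃₂; _×_; _,_; proj₁; proj₂)
open import Data.Sum using (_⊎_; inj₁; inj₂; [_,_]′)
import Data.Sum as Sum
open import Data.Empty using (⊥-elim)
open import Function using (_∘_)
open import Induction.WellFounded using (Acc; acc)
open import Relation.Nullary using (¬_; yes; no; contradiction)
open import Relation.Nullary.Decidable using (_×-dec_)
import Relation.Unary as U
open import Relation.Binary.Definitions using (Decidable)
open import Relation.Binary.PropositionalEquality as P using (_≡_; _≢_)

least-witness : ∀ {p} {P : U.Pred ℕ p} → U.Decidable P →
                ∀ {n} → P n → ∃ λ m → P m × (∀ {k} → k < m → ¬ P k)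
least-witness {P = P} P? {n} = go (<-wellFounded n)
  where
  go : ∀ {n} → Acc _<_ n → P n → ∃ λ m → P m × (∀ {k} → k < m → ¬ P k)
  go {n} (acc rs) Pn with anyUpTo? P? n
  ... | yes (k , k<n , Pk) = go (rs k<n) Pk
  ... | no ∄k             = n , Pn , λ k<n Pk → ∄k (_ , k<n , Pk)

p^m∣p^n : ∀ p {m n} → m ≤ n → p ^ m ∣ p ^ n
p^m∣p^n p {m} {n} m≤n = P.subst (p ^ m ∣_) p^[n∸m]*p^m≡p^n (n∣m*n (p ^ (n ∸ m)))
  where
  p^[n∸m]*p^m≡p^n : p ^ (n ∸ m) * p ^ m ≡ p ^ n
  p^[n∸m]*p^m≡p^n = P.trans (P.sym (^-distribˡ-+-* p (n ∸ m) m)) (P.cong (p ^_) (m∸n+n≡m m≤n))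

p^m∣p^n⊎p^n∣p^m : ∀ p m n → p ^ m ∣ p ^ n ⊎ p ^ n ∣ p ^ m
p^m∣p^n⊎p^n∣p^m p m n = Sum.map (p^m∣p^n p) (p^m∣p^n p) (≤-total m n)

prime∣p^n⇒≡ : ∀ {p q} n → Prime p → Prime q → q ∣ p ^ n → q ≡ p
prime∣p^n⇒≡ zero    _  pq q∣1 = contradiction (P.subst Prime (∣1⇒≡1 q∣1) pq) ¬prime[1]
prime∣p^n⇒≡ {p} (suc n) pp pq q∣p^[1+n] with euclidsLemma p (p ^ n) pq q∣p^[1+n]
... | inj₂ q∣p^n = prime∣p^n⇒≡ n pp pq q∣p^n
... | inj₁ q∣p with prime⇒irreducible pp q∣p
...   | inj₁ q≡1 = contradiction (P.subst Prime q≡1 pq) ¬prime[1]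
...   | inj₂ q≡p = q≡p

p^[1+m]∤q^n : ∀ {p q} m n → Prime p → Prime q → p ≢ q → ¬ p ^ suc m ∣ q ^ n
p^[1+m]∤q^n {p} m n pp pq p≢q p^[1+m]∣q^n = p≢q (prime∣p^n⇒≡ n pq pp (∣-trans (m∣m*n (p ^ m)) p^[1+m]∣q^n))

prime-divisor : ∀ {n} → 1 < n → ∃ λ q → Prime q × q ∣ n
prime-divisor {n@(suc _)} 1<n with factorise n
... | record { factors = [] ; isFactorisation = eq } = contradiction eq (<⇒≢ 1<n ∘ P.sym)
... | record { factors = q ∷ qs ; isFactorisation = eq ; factorsPrime = pq ∷ _ } =
  q , pq , P.subst (q ∣_) (P.sym eq) (m∣m*n (product qs))

prime-power-split : ∀ {q m} → Prime q → 0 < m → ∃₂ λ c e → m ≡ c * q ^ e × ¬ q ∣ c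
prime-power-split {q} {m} pq = split (<-wellFounded m)
  where
  split : ∀ {m} → Acc _<_ m → 0 < m → ∃₂ λ c e → m ≡ c * q ^ e × ¬ q ∣ c
  split {m} (acc rs) 0<m with q ∣? m
  ... | no q∤m = m , 0 , P.sym (*-identityʳ m) , q∤m
  ... | yes (divides zero P.refl) = contradiction 0<m (<-irrefl P.refl)
  ... | yes (divides (suc k) P.refl)
    with split (rs (m<m*n (suc k) q (nonTrivial⇒n>1 q {{prime⇒nonTrivial pq}}))) z<s
  ...   | c , e , 1+k≡c*q^e , q∤c = c , suc e , 1+k*q≡c*q^[1+e] , q∤c
    where
    1+k*q≡c*q^[1+e] : suc k * q ≡ c * q ^ suc e
    1+k*q≡c*q^[1+e] = begin
      suc k * q        ≡⟨ P.cong (_* q) 1+k≡c*q^e ⟩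
      c * q ^ e * q    ≡⟨ *-assoc c (q ^ e) q ⟩
      c * (q ^ e * q)  ≡⟨ P.cong (c *_) (*-comm (q ^ e) q) ⟩
      c * q ^ suc e    ∎
      where open P.≡-Reasoning

p-power⊎prime∣ : ∀ {p m} → Prime p → 0 < m → (∃ λ γ → m ≡ p ^ γ) ⊎ (∃ λ q → Prime q × q ≢ p × q ∣ m)
p-power⊎prime∣ {p} pp 0<m with prime-power-split pp 0<m
... | 0 , _ , P.refl , _ = contradiction 0<m (<-irrefl P.refl)
... | 1 , γ , m≡p^γ , _ = inj₁ (γ , P.trans m≡p^γ (*-identityˡ (p ^ γ)))
... | c@(suc (suc _)) , γ , m≡c*p^γ , p∤c with prime-divisor {c} (s≤s (s≤s z≤n))
...   | q , pq , q∣c =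
  inj₂ (q , pq , (λ { P.refl → p∤c q∣c }) , P.subst (q ∣_) (P.sym m≡c*p^γ) (∣m⇒∣m*n (p ^ γ) q∣c))

∣p^n⇒≡p^k : ∀ {p d} n → Prime p → d ∣ p ^ n → ∃ λ k → d ≡ p ^ k
∣p^n⇒≡p^k {p} {zero} n pp 0∣p^n =
  contradiction (0∣⇒≡0 0∣p^n) (≢-nonZero⁻¹ (p ^ n) {{m^n≢0 p n {{prime⇒nonZero pp}}}})
∣p^n⇒≡p^k {p} {d@(suc _)} n pp d∣p^n with p-power⊎prime∣ pp z<s
... | inj₁ d≡p^k = d≡p^k
... | inj₂ (q , pq , q≢p , q∣d) = contradiction (prime∣p^n⇒≡ n pp pq (∣-trans q∣d d∣p^n)) q≢p

module _ {c ℓ} (G : Group c ℓ) where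
  open Group G
  open import Algebra.Properties.Group G using (inverseˡ-unique; inverseʳ-unique; identityˡ-unique; x≈z//y)
  open import Algebra.Properties.Monoid.Mult monoid
    using (×-congʳ; ×-homo-+; ×-assocˡ) renaming (_×_ to _×ₘ_)
  open import Relation.Binary.Reasoning.Setoid setoid

  infixr 8 _^ᵍ_
  _^ᵍ_ : Carrier → ℕ → Carrier
  x ^ᵍ n = powℕ G x n

  ^ᵍ≡× : ∀ x n → x ^ᵍ n ≡ n ×ₘ x
  ^ᵍ≡× x zero    = P.refl
  ^ᵍ≡× x (suc n) = P.cong (x ∙_) (^ᵍ≡× x n)

  ^ᵍ-congˡ : ∀ {x y} n → x ≈ y → x ^ᵍ n ≈ y ^ᵍ n
  ^ᵍ-congˡ {x} {y} n x≈y = P.subst₂ _≈_ (P.sym (^ᵍ≡× x n)) (P.sym (^ᵍ≡× y n)) (×-congʳ n x≈y)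

  ^ᵍ-congʳ : ∀ x {m n} → m ≡ n → x ^ᵍ m ≈ x ^ᵍ n
  ^ᵍ-congʳ x m≡n = reflexive (P.cong (x ^ᵍ_) m≡n)

  ^ᵍ-homo-+ : ∀ x m n → x ^ᵍ (m + n) ≈ x ^ᵍ m ∙ x ^ᵍ n
  ^ᵍ-homo-+ x m n = P.subst₂ _≈_ (P.sym (^ᵍ≡× x (m + n))) (P.sym (P.cong₂ _∙_ (^ᵍ≡× x m) (^ᵍ≡× x n)))
    (×-homo-+ x m n)

  ^ᵍ-assoc : ∀ x m n → (x ^ᵍ m) ^ᵍ n ≈ x ^ᵍ (n * m)
  ^ᵍ-assoc x m n = P.subst₂ _≈_ (P.sym (P.trans (^ᵍ≡× (x ^ᵍ m) n) (P.cong (n ×ₘ_) (^ᵍ≡× x m))))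
    (P.sym (^ᵍ≡× x (n * m))) (×-assocˡ x n m)

  ε^ᵍn≈ε : ∀ n → ε ^ᵍ n ≈ ε
  ε^ᵍn≈ε zero    = refl
  ε^ᵍn≈ε (suc n) = trans (identityˡ _) (ε^ᵍn≈ε n)

  ^ᵍ-≈ε-∣ : ∀ x {d n} → x ^ᵍ d ≈ ε → d ∣ n → x ^ᵍ n ≈ ε
  ^ᵍ-≈ε-∣ x {d} x^d≈ε (divides k P.refl) = begin
    x ^ᵍ (k * d)   ≈⟨ ^ᵍ-assoc x d k ⟨
    (x ^ᵍ d) ^ᵍ k  ≈⟨ ^ᵍ-congˡ k x^d≈ε ⟩
    ε ^ᵍ k         ≈⟨ ε^ᵍn≈ε k ⟩
    ε              ∎

  ^ᵍ-of-power : ∀ {x} g a k → x ≈ g ^ᵍ a → x ^ᵍ k ≈ g ^ᵍ (k * a)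
  ^ᵍ-of-power g a k x≈g^a = trans (^ᵍ-congˡ k x≈g^a) (^ᵍ-assoc g a k)

  order∣ : ∀ {x d n} → IsOrder G x d → x ^ᵍ n ≈ ε → d ∣ n
  order∣ {x} {d@(suc _)} {n} (_ , x^d≈ε , minimal) x^n≈ε with n % d in r≡n%d
  ... | zero  = m%n≡0⇒n∣m n d r≡n%d
  ... | suc r = contradiction x^r≈ε (minimal (suc r) z<s (P.subst (_< d) r≡n%d (m%n<n n d)))
    where
    x^r≈ε : x ^ᵍ suc r ≈ ε
    x^r≈ε = begin
      x ^ᵍ suc r                         ≈⟨ identityʳ _ ⟨
      x ^ᵍ suc r ∙ ε                     ≈⟨ ∙-congˡ (^ᵍ-≈ε-∣ x x^d≈ε (n∣m*n (n / d))) ⟨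
      x ^ᵍ suc r ∙ x ^ᵍ (n / d * d)      ≈⟨ ^ᵍ-homo-+ x (suc r) (n / d * d) ⟨
      x ^ᵍ (suc r + n / d * d)           ≡⟨ P.cong (λ i → x ^ᵍ (i + n / d * d)) r≡n%d ⟨
      x ^ᵍ (n % d + n / d * d)           ≡⟨ P.cong (x ^ᵍ_) (m≡m%n+[m/n]*n n d) ⟨
      x ^ᵍ n                             ≈⟨ x^n≈ε ⟩
      ε                                  ∎

  ⁻¹≈^ᵍ : ∀ {x n} → x ^ᵍ suc n ≈ ε → x ⁻¹ ≈ x ^ᵍ n
  ⁻¹≈^ᵍ {x} {n} x^[1+n]≈ε = sym (inverseʳ-unique x (x ^ᵍ n) x^[1+n]≈ε)

  ≈^ᵍ⇒^ᵍ≈ε : ∀ {x} g a n → x ≈ g ^ᵍ a → g ^ᵍ n ≈ ε → x ^ᵍ n ≈ ε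
  ≈^ᵍ⇒^ᵍ≈ε g a n x≈g^a g^n≈ε = trans (^ᵍ-of-power g a n x≈g^a) (^ᵍ-≈ε-∣ g {n} g^n≈ε (m∣m*n a))

  inCyc⇒≈^ᵍ : ∀ {x y d} → IsOrder G y d → InCyc G x y → ∃ λ k → x ≈ y ^ᵍ k
  inCyc⇒≈^ᵍ _ (+ k , x≈y^k) = k , x≈y^k
  inCyc⇒≈^ᵍ {x} {y} {suc d} (_ , y^[1+d]≈ε , _) (-[1+ k ] , x≈y⁻¹^[1+k]) = suc k * d , (begin
    x                   ≈⟨ x≈y⁻¹^[1+k] ⟩
    (y ⁻¹) ^ᵍ suc k     ≈⟨ ^ᵍ-congˡ (suc k) (⁻¹≈^ᵍ {n = d} y^[1+d]≈ε) ⟩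
    (y ^ᵍ d) ^ᵍ suc k   ≈⟨ ^ᵍ-assoc y d (suc k) ⟩
    y ^ᵍ (suc k * d)    ∎)

  inCyc⇒order∣ : ∀ {x y m n} → IsOrder G x m → IsOrder G y n → InCyc G x y → m ∣ n
  inCyc⇒order∣ {y = y} {n = n} ox oy@(_ , y^n≈ε , _) x∈⟨y⟩ with inCyc⇒≈^ᵍ oy x∈⟨y⟩
  ... | k , x≈y^k = order∣ ox (≈^ᵍ⇒^ᵍ≈ε y k n x≈y^k y^n≈ε)

  finite⇒≈-dec : IsFinite G → Decidable _≈_
  finite⇒≈-dec (_ , f , surjective , injective) x y with surjective x | surjective y
  ... | i , fi≈x | j , fj≈y with i Fin.≟ j
  ... | yes P.refl = yes (trans (sym fi≈x) fj≈y)
  ... | no i≢j     = no (λ x≈y → i≢j (injective i j (trans fi≈x (trans x≈y (sym fj≈y)))))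

  finite⇒^ᵍ≈ε : IsFinite G → ∀ x → ∃ λ n → 0 < n × x ^ᵍ n ≈ ε
  finite⇒^ᵍ≈ε (n , f , surjective , _) x
    with i , j , i<j , same-index ← Fin.pigeonhole (n<1+n n) (proj₁ ∘ surjective ∘ (x ^ᵍ_) ∘ toℕ)
    = toℕ j ∸ toℕ i , m<n⇒0<n∸m i<j , identityˡ-unique _ (x ^ᵍ toℕ i) (begin
      x ^ᵍ (toℕ j ∸ toℕ i) ∙ x ^ᵍ toℕ i  ≈⟨ ^ᵍ-homo-+ x (toℕ j ∸ toℕ i) (toℕ i) ⟨
      x ^ᵍ (toℕ j ∸ toℕ i + toℕ i)       ≈⟨ ^ᵍ-congʳ x (m∸n+n≡m (<⇒≤ i<j)) ⟩
      x ^ᵍ toℕ j                         ≈⟨ proj₂ (surjective (x ^ᵍ toℕ j)) ⟨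
      f _                                ≡⟨ P.cong f same-index ⟨
      f _                                ≈⟨ proj₂ (surjective (x ^ᵍ toℕ i)) ⟩
      x ^ᵍ toℕ i                         ∎)

  finite⇒order : IsFinite G → ∀ x → ∃ (IsOrder G x)
  finite⇒order fin x with _ , 0<n , x^n≈ε ← finite⇒^ᵍ≈ε fin x
    with d , (0<d , x^d≈ε) , below-d ←
           least-witness (λ k → 0 <? k ×-dec finite⇒≈-dec fin (x ^ᵍ k) ε) (0<n , x^n≈ε)
    = d , 0<d , x^d≈ε , λ j 0<j j<d x^j≈ε → below-d j<d (0<j , x^j≈ε)

  gen-^ᵍ : ∀ {x y z} k → Gen2 G x y z → Gen2 G x y (z ^ᵍ k)
  gen-^ᵍ zero    _   = gen-ε
  gen-^ᵍ (suc k) z∈ = gen-∙ z∈ (gen-^ᵍ k z∈)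

  -- The generator is g ^ gcd a b, which Bézout's identity writes as a quotient of powers of x and y.
  powers⇒cyclicPair : ∀ {x y} g a b → x ≈ g ^ᵍ a → y ≈ g ^ᵍ b → CyclicPair G x y
  powers⇒cyclicPair {x} {y} g a b x≈g^a y≈g^b =
    h , h∈⟨x,y⟩ (Bézout.identity (gcd-GCD a b)) , ∈⟨h⟩ x≈g^a (gcd[m,n]∣m a b) , ∈⟨h⟩ y≈g^b (gcd[m,n]∣n a b)
    where
    h : Carrier
    h = g ^ᵍ gcd a b

    ∈⟨h⟩ : ∀ {z c} → z ≈ g ^ᵍ c → gcd a b ∣ c → InCyc G z h
    ∈⟨h⟩ z≈g^c (divides k P.refl) = + k , trans z≈g^c (sym (^ᵍ-assoc g (gcd a b) k))

    quotient∈⟨x,y⟩ : ∀ {z w c e} u v → z ≈ g ^ᵍ c → w ≈ g ^ᵍ e →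
                     Gen2 G x y z → Gen2 G x y w → gcd a b + v * e ≡ u * c → Gen2 G x y h
    quotient∈⟨x,y⟩ {z} {w} {c} {e} u v z≈g^c w≈g^e z∈ w∈ eq =
      gen-≈ (sym (x≈z//y h (w ^ᵍ v) (z ^ᵍ u) h∙w^v≈z^u)) (gen-∙ (gen-^ᵍ u z∈) (gen-⁻¹ (gen-^ᵍ v w∈)))
      where
      h∙w^v≈z^u : h ∙ w ^ᵍ v ≈ z ^ᵍ u
      h∙w^v≈z^u = begin
        h ∙ w ^ᵍ v               ≈⟨ ∙-congˡ (^ᵍ-of-power g e v w≈g^e) ⟩
        h ∙ g ^ᵍ (v * e)         ≈⟨ ^ᵍ-homo-+ g (gcd a b) (v * e) ⟨
        g ^ᵍ (gcd a b + v * e)   ≈⟨ ^ᵍ-congʳ g eq ⟩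
        g ^ᵍ (u * c)             ≈⟨ ^ᵍ-of-power g c u z≈g^c ⟨
        z ^ᵍ u                   ∎

    h∈⟨x,y⟩ : Bézout.Identity (gcd a b) a b → Gen2 G x y h
    h∈⟨x,y⟩ (Bézout.+- u v eq) = quotient∈⟨x,y⟩ u v x≈g^a y≈g^b gen-x gen-y eq
    h∈⟨x,y⟩ (Bézout.-+ u v eq) = quotient∈⟨x,y⟩ v u y≈g^b x≈g^a gen-y gen-x eq

  order-^ᵍ⇒coprime : ∀ {h z} a {n} → IsOrder G h n → z ≈ h ^ᵍ a → IsOrder G z n → Coprime a n
  order-^ᵍ⇒coprime {h} {z} a {n} (0<n , h^n≈ε , _) z≈h^a oz {e} (divides t P.refl , divides f n≡f*e) =
    P.sym (*-cancelˡ-≡ 1 e n (P.trans (*-identityʳ n) (P.trans n≡f*e (P.cong (_* e) f≡n))))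
    where
    instance _ = >-nonZero 0<n
    z^f≈ε : z ^ᵍ f ≈ ε
    z^f≈ε = begin
      z ^ᵍ f              ≈⟨ ^ᵍ-of-power h (t * e) f z≈h^a ⟩
      h ^ᵍ (f * (t * e))  ≈⟨ ^ᵍ-congʳ h (P.trans (x∙yz≈y∙xz f t e) (P.cong (t *_) (P.sym n≡f*e))) ⟩
      h ^ᵍ (t * n)        ≈⟨ ^ᵍ-≈ε-∣ h h^n≈ε (n∣m*n t) ⟩
      ε                   ∎
    f≡n : f ≡ n
    f≡n = ∣-antisym (divides e (P.trans n≡f*e (*-comm f e))) (order∣ oz z^f≈ε)

  coprime⇒generator : ∀ {h z} a {n} .{{_ : NonZero n}} → h ^ᵍ n ≈ ε → z ≈ h ^ᵍ a → Coprime a n →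
                      ∃ λ s → h ≈ z ^ᵍ s
  coprime⇒generator {h} {z} a {n@(suc n-1)} h^n≈ε z≈h^a a⊥n with coprime-Bézout a⊥n
  ... | Bézout.+- u v eq = u , sym (begin
    z ^ᵍ u                 ≈⟨ ^ᵍ-of-power h a u z≈h^a ⟩
    h ^ᵍ (u * a)           ≈⟨ ^ᵍ-congʳ h eq ⟨
    h ^ᵍ (1 + v * n)       ≈⟨ ^ᵍ-homo-+ h 1 (v * n) ⟩
    h ^ᵍ 1 ∙ h ^ᵍ (v * n)  ≈⟨ ∙-cong (identityʳ h) (^ᵍ-≈ε-∣ h h^n≈ε (n∣m*n v)) ⟩
    h ∙ ε                  ≈⟨ identityʳ h ⟩
    h                      ∎)
  ... | Bézout.-+ u v eq = n-1 * u , (begin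
    h                  ≈⟨ inverseˡ-unique h (z ^ᵍ u) h∙z^u≈ε ⟩
    (z ^ᵍ u) ⁻¹        ≈⟨ ⁻¹≈^ᵍ {n = n-1} (≈^ᵍ⇒^ᵍ≈ε h (u * a) n (^ᵍ-of-power h a u z≈h^a) h^n≈ε) ⟩
    (z ^ᵍ u) ^ᵍ n-1    ≈⟨ ^ᵍ-assoc z u n-1 ⟩
    z ^ᵍ (n-1 * u)     ∎)
    where
    h∙z^u≈ε : h ∙ z ^ᵍ u ≈ ε
    h∙z^u≈ε = begin
      h ∙ z ^ᵍ u             ≈⟨ ∙-cong (sym (identityʳ h)) (^ᵍ-of-power h a u z≈h^a) ⟩
      h ^ᵍ 1 ∙ h ^ᵍ (u * a)  ≈⟨ ^ᵍ-homo-+ h 1 (u * a) ⟨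
      h ^ᵍ (1 + u * a)       ≈⟨ ^ᵍ-congʳ h eq ⟩
      h ^ᵍ (v * n)           ≈⟨ ^ᵍ-≈ε-∣ h h^n≈ε (n∣m*n v) ⟩
      ε                      ∎

  module Cyclic {g m} (og : IsOrder G g m) where
    private
      g^m≈ε : g ^ᵍ m ≈ ε
      g^m≈ε = proj₁ (proj₂ og)

    factors≢0 : ∀ c {d} → m ≡ c * d → NonZero c × NonZero d
    factors≢0 c m≡c*d = m*n≢0⇒m≢0 c , m*n≢0⇒n≢0 c
      where instance _ = >-nonZero (P.subst (0 <_) m≡c*d (proj₁ og))

    order∣m : ∀ {x} a {d} → x ≈ g ^ᵍ a → IsOrder G x d → d ∣ m
    order∣m a x≈g^a ox = order∣ ox (≈^ᵍ⇒^ᵍ≈ε g a m x≈g^a g^m≈ε)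

    order-^ᵍ : ∀ c {d} → m ≡ c * d → IsOrder G (g ^ᵍ c) d
    order-^ᵍ c {d} m≡c*d = >-nonZero⁻¹ d , g^c^d≈ε , minimal
      where
      instance
        c≢0 : NonZero c
        c≢0 = proj₁ (factors≢0 c m≡c*d)
        d≢0 : NonZero d
        d≢0 = proj₂ (factors≢0 c m≡c*d)
      g^c^d≈ε : (g ^ᵍ c) ^ᵍ d ≈ ε
      g^c^d≈ε = trans (^ᵍ-assoc g c d) (trans (^ᵍ-congʳ g (P.trans (*-comm d c) (P.sym m≡c*d))) g^m≈ε)
      minimal : ∀ j → 0 < j → j < d → ¬ (g ^ᵍ c) ^ᵍ j ≈ ε
      minimal j@(suc _) _ j<d g^c^j≈ε = <⇒≱ j<d (∣⇒≤ (*-cancelˡ-∣ c (P.subst (_∣ c * j) m≡c*d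
        (order∣ og (trans (^ᵍ-congʳ g (*-comm c j)) (trans (sym (^ᵍ-assoc g c j)) g^c^j≈ε))))))

    ^ᵍ≈ε⇒∈⟨g^c⟩ : ∀ {w} c b {d} → m ≡ c * d → w ≈ g ^ᵍ b → w ^ᵍ d ≈ ε → ∃ λ k → w ≈ (g ^ᵍ c) ^ᵍ k
    ^ᵍ≈ε⇒∈⟨g^c⟩ {w} c b {d} m≡c*d w≈g^b w^d≈ε = ∈⟨g^c⟩ (*-cancelʳ-∣ d c*d∣b*d)
      where
      instance _ = proj₂ (factors≢0 c m≡c*d)
      c*d∣b*d : c * d ∣ b * d
      c*d∣b*d = P.subst (_∣ b * d) m≡c*d (order∣ og (begin
        g ^ᵍ (b * d)  ≡⟨ P.cong (g ^ᵍ_) (*-comm b d) ⟩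
        g ^ᵍ (d * b)  ≈⟨ ^ᵍ-of-power g b d w≈g^b ⟨
        w ^ᵍ d        ≈⟨ w^d≈ε ⟩
        ε             ∎))
      ∈⟨g^c⟩ : c ∣ b → ∃ λ k → w ≈ (g ^ᵍ c) ^ᵍ k
      ∈⟨g^c⟩ (divides k P.refl) = k , trans w≈g^b (sym (^ᵍ-assoc g c k))

    -- ⟨g⟩ has a single subgroup of each order d ∣ m, namely ⟨g ^ (m / d)⟩.
    order∣⇒inCyc : ∀ {z w} a b {d e} → z ≈ g ^ᵍ a → IsOrder G z d → w ≈ g ^ᵍ b → IsOrder G w e → e ∣ d →
                   InCyc G w z
    order∣⇒inCyc {z} {w} a b {d} z≈g^a oz@(0<d , z^d≈ε , _) w≈g^b (_ , w^e≈ε , _) e∣d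
      with divides c m≡c*d ← order∣m a z≈g^a oz
      with a′ , z≈h^a′ ← ^ᵍ≈ε⇒∈⟨g^c⟩ c a m≡c*d z≈g^a z^d≈ε
         | b′ , w≈h^b′ ← ^ᵍ≈ε⇒∈⟨g^c⟩ c b m≡c*d w≈g^b (^ᵍ-≈ε-∣ w w^e≈ε e∣d)
      with oh@(_ , h^d≈ε , _) ← order-^ᵍ c m≡c*d
      with s , h≈z^s ←
             coprime⇒generator a′ {{>-nonZero 0<d}} h^d≈ε z≈h^a′ (order-^ᵍ⇒coprime a′ oh z≈h^a′ oz)
      = + (b′ * s) , (begin
        w                   ≈⟨ w≈h^b′ ⟩
        (g ^ᵍ c) ^ᵍ b′       ≈⟨ ^ᵍ-congˡ b′ h≈z^s ⟩
        (z ^ᵍ s) ^ᵍ b′       ≈⟨ ^ᵍ-assoc z s b′ ⟩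
        z ^ᵍ (b′ * s)        ∎)

    dAdj-^ᵍ : ∀ {x} a c {n d} → x ≈ g ^ᵍ a → IsOrder G x n → m ≡ c * d → ¬ d ∣ n → ¬ n ∣ d →
              DAdj G x (g ^ᵍ c)
    dAdj-^ᵍ a c x≈g^a ox m≡c*d d∤n n∤d =
        powers⇒cyclicPair g a c x≈g^a refl
      , n∤d ∘ inCyc⇒order∣ ox (order-^ᵍ c m≡c*d)
      , d∤n ∘ inCyc⇒order∣ (order-^ᵍ c m≡c*d) ox

  module DNeighbours {g m} (og : IsOrder G g m) {x y} a b (x≈g^a : x ≈ g ^ᵍ a) (y≈g^b : y ≈ g ^ᵍ b)
                     (x∉⟨y⟩ : ¬ InCyc G x y) (y∉⟨x⟩ : ¬ InCyc G y x) {n₀} (oy : IsOrder G y n₀) where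
    open Cyclic og

    private
      0<m : 0 < m
      0<m = proj₁ og

    n₀∤order : ∀ {n} → IsOrder G x n → ¬ n₀ ∣ n
    n₀∤order ox = y∉⟨x⟩ ∘ order∣⇒inCyc a b x≈g^a ox y≈g^b oy

    order∤n₀ : ∀ {n} → IsOrder G x n → ¬ n ∣ n₀
    order∤n₀ ox = x∉⟨y⟩ ∘ order∣⇒inCyc b a y≈g^b oy x≈g^a ox

    prime-power-order-neighbour : ∀ p α → Prime p → IsOrder G x (p ^ α) →
      Σ ℕ λ q → Σ ℕ λ β → Σ Carrier λ y′ → Prime q × q ≢ p × IsOrder G y′ (q ^ β) × DAdj G x y′
    prime-power-order-neighbour p zero _ ox = contradiction (1∣ n₀) (order∤n₀ ox)
    prime-power-order-neighbour p α@(suc α-1) pp ox with p-power⊎prime∣ pp 0<m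
    ... | inj₁ (γ , m≡p^γ)
      with j , n₀≡p^j ← ∣p^n⇒≡p^k γ pp (P.subst (n₀ ∣_) m≡p^γ (order∣m b y≈g^b oy))
      = ⊥-elim ([ n₀∤order ox ∘ P.subst (_∣ p ^ α) (P.sym n₀≡p^j)
                , order∤n₀ ox ∘ P.subst (p ^ α ∣_) (P.sym n₀≡p^j) ]′ (p^m∣p^n⊎p^n∣p^m p j α))
    ... | inj₂ (q , pq , q≢p , q∣m) with prime-power-split pq 0<m
    ...   | c , zero , m≡c*1 , q∤c = contradiction (P.subst (q ∣_) (P.trans m≡c*1 (*-identityʳ c)) q∣m) q∤c
    ...   | c , e@(suc e-1) , m≡c*q^e , q∤c =
      q , e , g ^ᵍ c , pq , q≢p , order-^ᵍ c m≡c*q^e ,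
      dAdj-^ᵍ a c x≈g^a ox m≡c*q^e (p^[1+m]∤q^n e-1 α pq pp q≢p) (p^[1+m]∤q^n α-1 e pp pq (q≢p ∘ P.sym))

    non-prime-power-order-neighbour : ∀ n → IsOrder G x n → ¬ IsPrimePower n →
      Σ ℕ λ p → Σ ℕ λ α → Σ Carrier λ y′ → Prime p × IsOrder G y′ (p ^ α) × DAdj G x y′
    non-prime-power-order-neighbour n ox n≢p^α with order∣m a x≈g^a ox
    ... | divides zero m≡0 = contradiction m≡0 (<⇒≢ 0<m ∘ P.sym)
    ... | divides 1 m≡1*n =
      contradiction (P.subst (n₀ ∣_) (P.trans m≡1*n (*-identityˡ n)) (order∣m b y≈g^b oy)) (n₀∤order ox)
    ... | divides t@(suc (suc _)) m≡t*n
      with q , pq , q∣t ← prime-divisor {t} (s≤s (s≤s z≤n))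
      with c , e , m≡c*q^e , q∤c ← prime-power-split pq 0<m
      = q , e , g ^ᵍ c , pq , order-^ᵍ c m≡c*q^e , dAdj-^ᵍ a c x≈g^a ox m≡c*q^e q^e∤n n∤q^e
      where
      n∤q^e : ¬ n ∣ q ^ e
      n∤q^e n∣q^e with k , n≡q^k ← ∣p^n⇒≡p^k e pq n∣q^e = n≢p^α (q , k , pq , n≡q^k)
      q^e∤n : ¬ q ^ e ∣ n
      q^e∤n (divides k P.refl) = q∤c (P.subst (q ∣_) (P.sym c≡t*k) (∣m⇒∣m*n k q∣t))
        where
        instance _ = m^n≢0 q e {{prime⇒nonZero pq}}
        c≡t*k : c ≡ t * k
        c≡t*k = *-cancelʳ-≡ c (t * k) (q ^ e)
          (P.trans (P.sym m≡c*q^e) (P.trans m≡t*n (P.sym (*-assoc t k (q ^ e)))))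

lemma2p8 : ∀ {c ℓ} (G : Group c ℓ) → IsFinite G → (x : Group.Carrier G) → IsVertexD G x →
    ((p α : ℕ) → Prime p → IsOrder G x (p ^ α) →
      Σ ℕ λ q → Σ ℕ λ β → Σ (Group.Carrier G) λ y →
        Prime q × q ≢ p × IsOrder G y (q ^ β) × DAdj G x y)
    ×
    ((n : ℕ) → IsOrder G x n → ¬ IsPrimePower n →
      Σ ℕ λ p → Σ ℕ λ α → Σ (Group.Carrier G) λ y →
        Prime p × IsOrder G y (p ^ α) × DAdj G x y)
lemma2p8 G fin x (y , (g , _ , x∈⟨g⟩ , y∈⟨g⟩) , x∉⟨y⟩ , y∉⟨x⟩)
  with _ , og ← finite⇒order G fin g
     | _ , oy ← finite⇒order G fin y
  with a , x≈g^a ← inCyc⇒≈^ᵍ G og x∈⟨g⟩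
     | b , y≈g^b ← inCyc⇒≈^ᵍ G og y∈⟨g⟩
  = prime-power-order-neighbour , non-prime-power-order-neighbour
  where open DNeighbours G og a b x≈g^a y≈g^b x∉⟨y⟩ y∉⟨x⟩ oy
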